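{- There exists a sentence $\varphi$ of the pure language of set theory $\mathcal{L}_\in$ (e.g. $\varphi:=\exists x\exists y(x\in y\wedge\neg(x\in y))$) such that for every designated $\mathsf{Cobounded}$-algebra $(\mathbb{A},D)$ in which $D$ contains at least two elements, both $\mathbf{V}^{(\mathbb{A}),\llbracket\cdot\rrbracket_{\mathrm{BA}}}\models_D\varphi\wedge\neg\varphi$ and $\mathbf{V}^{(\mathbb{A}),\llbracket\cdot\rrbracket_{\mathrm{PA}}}\models_D\varphi\wedge\neg\varphi$.
   Context: A designated set of a bounded lattice is a filter $D$ with $\mathbf{1}\in D$, $\mathbf{0}\notin D$. A $\mathsf{Cobounded}$-algebra is $\langle\mathbf{A},\wedge,\vee,\Rightarrow,\mathbf{1},\mathbf{0}\rangle$ whose lattice reduct is a complete distributive lattice, such that $\bigvee_{i}a_i=\mathbf{1}$ implies some $a_j=\mathbf{1}$, $\bigwedge_i a_i=\mathbf{0}$ implies some $a_j=\mathbf{0}$, and $a\Rightarrow b=\mathbf{0}$ if $a\neq\mathbf{0}$, $b=\mathbf{0}$, and $=\mathbf{1}$ otherwise. A designated $\mathsf{Cobounded}$-algebra is $(\mathbb{A},D)$, $\mathbb{A}=\langle\mathbf{A},\wedge,\vee,\Rightarrow,{}^*,\mathbf{1},\mathbf{0}\rangle$, with $\mathsf{Cobounded}$ ${}^*$-free reduct, $D$ a designated set, $a^*=\mathbf{0}$ if $a=\mathbf{1}$, $a^*=a$ if $a\in D\setminus\{\mathbf{1}\}$, $a^*=\mathbf{1}$ if $a\notin D$. $\mathbf{V}^{(\mathbb{A})}$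 is the class of functions built by recursion: $\mathbf{V}^{(\mathbb{A})}_\alpha$ = functions $x$ with values in $\mathbf{A}$ and $\mathrm{dom}(x)\subseteq\mathbf{V}^{(\mathbb{A})}_\xi$ for some $\xi<\alpha$; $\mathbf{V}^{(\mathbb{A})}=\bigcup_\alpha\mathbf{V}^{(\mathbb{A})}_\alpha$. Two assignment functions on sentences (with constants from $\mathbf{V}^{(\mathbb{A})}$): $\llbracket u\in v\rrbracket_{\mathrm{BA}}=\bigvee_{x\in\mathrm{dom}(v)}(v(x)\wedge\llbracket x=u\rrbracket_{\mathrm{BA}})$, $\llbracket u=v\rrbracket_{\mathrm{BA}}=\bigwedge_{x\in\mathrm{dom}(u)}(u(x)\Rightarrow\llbracket x\in v\rrbracket_{\mathrm{BA}})\wedge\bigwedge_{y\in\mathrm{dom}(v)}(v(y)\Rightarrow\llbracket y\in u\rrbracket_{\mathrm{BA}})$; $\llbracket u\in v\rrbracket_{\mathrm{PA}}=\bigvee_{x\in\mathrm{dom}(v)}(v(x)\wedge\llbracket x=u\rrbracket_{\mathrm{PA}})$, $\llbracket u=v\rrbracket_{\mathrm{PA}}=\bigwedge_{x\in\mathrm{dom}(u)}((u(x)\Rightarrow\llbracket x\in v\rrbracket_{\mathrm{PA}})\wedge(\llbracket x\in v\rrbracket_{\mathrm{PA}}^*\Rightarrow u(x)^*))\wedge\bigwedge_{y\in\mathrm{dom}(v)}((v(y)\Rightarrow\llbracket y\in u\rrbracket_{\mathrm{PA}})\wedge(\llbracket y\in u\rrbracket_{\mathrm{PA}}^*\Rightarrow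 v(y)^*))$; both extended by $\top\mapsto\mathbf{1}$, $\bot\mapsto\mathbf{0}$, $\wedge,\vee,\to,\neg\mapsto\wedge,\vee,\Rightarrow,{}^*$, and $\forall,\exists\mapsto\bigwedge,\bigvee$ over $\mathbf{V}^{(\mathbb{A})}$. $\models_D\varphi$ means the value of $\varphi$ lies in $D$. -}

module Defs where

open import Level using (Level; _⊔_; Lift; lift; lower; Setω) renaming (suc to lsuc)
open import Data.Nat using (ℕ; zero; suc)
open import Data.Fin using (Fin; zero; suc)
open import Data.Product using (Σ; ∃; _×_; _,_)
open import Relation.Binary.PropositionalEquality using (_≡_; _≢_)
open import Relation.Nullary using (¬_)
open import Algebra.Lattice.Structures using (IsDistributiveLattice)

-- Carrier in Set a; completeness (arbitrary ⋀, ⋁) is required for all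
-- families indexed by types in Set (lsuc j ⊔ a), which is large enough
-- to include all subsets of the carrier and the class of names built
-- with domains indexed by types in Set j (needed for quantifiers).

record DCobounded (a j : Level) : Set (lsuc (lsuc j ⊔ a)) where
  infixr 7 _∧_
  infixr 6 _∨_
  infixr 5 _⇒_
  field
    Carrier : Set a
    _∧_ _∨_ _⇒_ : Carrier → Carrier → Carrier
    _*          : Carrier → Carrier
    𝟏 𝟎         : Carrier
    ⋀ ⋁         : {I : Set (lsuc j ⊔ a)} → (I → Carrier) → Carrier
    D           : Carrier → Set a

  _≤_ : Carrier → Carrier → Set a
  x ≤ y = x ∧ y ≡ x

  field
    isDistributiveLattice : IsDistributiveLattice _≡_ _∨_ _∧_
    𝟎-least   : ∀ x → 𝟎 ≤ x
    𝟏-greatest : ∀ x → x ≤ 𝟏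
    ⋀-lower   : ∀ {I} (f : I → Carrier) i → ⋀ f ≤ f i
    ⋀-greatest : ∀ {I} (f : I → Carrier) x → (∀ i → x ≤ f i) → x ≤ ⋀ f
    ⋁-upper   : ∀ {I} (f : I → Carrier) i → f i ≤ ⋁ f
    ⋁-least   : ∀ {I} (f : I → Carrier) x → (∀ i → f i ≤ x) → ⋁ f ≤ x
    ⋁-cobounded : ∀ {I} (f : I → Carrier) → ⋁ f ≡ 𝟏 → ∃ λ i → f i ≡ 𝟏
    ⋀-cobounded : ∀ {I} (f : I → Carrier) → ⋀ f ≡ 𝟎 → ∃ λ i → f i ≡ 𝟎
    ⇒-𝟎 : ∀ x y → x ≢ 𝟎 → y ≡ 𝟎 → x ⇒ y ≡ 𝟎
    ⇒-𝟏 : ∀ x y → ¬ (x ≢ 𝟎 × y ≡ 𝟎) → x ⇒ y ≡ 𝟏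
    D-𝟏   : D 𝟏
    D-𝟎   : ¬ D 𝟎
    D-up  : ∀ x y → D x → x ≤ y → D y
    D-∧   : ∀ x y → D x → D y → D (x ∧ y)
    *-𝟏 : ∀ x → x ≡ 𝟏 → x * ≡ 𝟎
    *-D : ∀ x → D x → x ≢ 𝟏 → x * ≡ x
    *-¬D : ∀ x → ¬ D x → x * ≡ 𝟏

module _ {a j : Level} (𝔸 : DCobounded a j) where
  open DCobounded 𝔸

  -- The universe V^(A): a name is a family of (name, value) pairs
  -- indexed by a type in Set j (domain with values in the carrier).
  data Name : Set (lsuc j ⊔ a) where
    sup : (I : Set j) → (I → Name) → (I → Carrier) → Name

  ⋀ⱼ ⋁ⱼ : {I : Set j} → (I → Carrier) → Carrier
  ⋀ⱼ {I} f = ⋀ {Lift (lsuc j ⊔ a) I} (λ i → f (lower i))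
  ⋁ⱼ {I} f = ⋁ {Lift (lsuc j ⊔ a) I} (λ i → f (lower i))

  eqBA : Name → Name → Carrier
  eqBA (sup I f x) (sup J g y) =
    ⋀ⱼ (λ i → x i ⇒ ⋁ⱼ (λ k → y k ∧ eqBA (g k) (f i)))
    ∧ ⋀ⱼ (λ k → y k ⇒ ⋁ⱼ (λ i → x i ∧ eqBA (f i) (g k)))

  memBA : Name → Name → Carrier
  memBA u (sup J g y) = ⋁ⱼ (λ k → y k ∧ eqBA (g k) u)

  eqPA : Name → Name → Carrier
  eqPA (sup I f x) (sup J g y) =
    ⋀ⱼ (λ i → (x i ⇒ ⋁ⱼ (λ k → y k ∧ eqPA (g k) (f i)))
              ∧ ((⋁ⱼ (λ k → y k ∧ eqPA (g k) (f i))) * ⇒ (x i) *))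
    ∧ ⋀ⱼ (λ k → (y k ⇒ ⋁ⱼ (λ i → x i ∧ eqPA (f i) (g k)))
              ∧ ((⋁ⱼ (λ i → x i ∧ eqPA (f i) (g k))) * ⇒ (y k) *))

  memPA : Name → Name → Carrier
  memPA u (sup J g y) = ⋁ⱼ (λ k → y k ∧ eqPA (g k) u)

-- Formulas of the pure language L_∈ (de Bruijn variables).

data Formula (n : ℕ) : Set where
  _∈'_ _≐_ : Fin n → Fin n → Formula n
  ⊤' ⊥' : Formula n
  _∧'_ _∨'_ _⇒'_ : Formula n → Formula n → Formula n
  ¬'_ : Formula n → Formula n
  ∀' ∃' : Formula (suc n) → Formula n

Sentence : Set
Sentence = Formula zero

module _ {a j : Level} (𝔸 : DCobounded a j) where
  open DCobounded 𝔸

  Env : ℕ → Set (lsuc j ⊔ a)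
  Env n = Fin n → Name 𝔸

  extend : ∀ {n} → Env n → Name 𝔸 → Env (suc n)
  extend ρ x zero = x
  extend ρ x (suc i) = ρ i

  eval : (mem eq : Name 𝔸 → Name 𝔸 → Carrier) → ∀ {n} → Formula n → Env n → Carrier
  eval mem eq (x ∈' y) ρ = mem (ρ x) (ρ y)
  eval mem eq (x ≐ y) ρ = eq (ρ x) (ρ y)
  eval mem eq ⊤' ρ = 𝟏
  eval mem eq ⊥' ρ = 𝟎
  eval mem eq (φ ∧' ψ) ρ = eval mem eq φ ρ ∧ eval mem eq ψ ρ
  eval mem eq (φ ∨' ψ) ρ = eval mem eq φ ρ ∨ eval mem eq ψ ρ
  eval mem eq (φ ⇒' ψ) ρ = eval mem eq φ ρ ⇒ eval mem eq ψ ρ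
  eval mem eq (¬' φ) ρ = (eval mem eq φ ρ) *
  eval mem eq (∀' φ) ρ = ⋀ (λ x → eval mem eq φ (extend ρ x))
  eval mem eq (∃' φ) ρ = ⋁ (λ x → eval mem eq φ (extend ρ x))

  emptyEnv : Env zero
  emptyEnv ()

  ⊨BA : Sentence → Set a
  ⊨BA φ = D (eval (memBA 𝔸) (eqBA 𝔸) φ emptyEnv)

  ⊨PA : Sentence → Set a
  ⊨PA φ = D (eval (memPA 𝔸) (eqPA 𝔸) φ emptyEnv)

  AtLeastTwoDesignated : Set a
  AtLeastTwoDesignated = Σ Carrier λ x → Σ Carrier λ y → D x × D y × x ≢ y

record ΣSentenceω (P : Sentence → Setω) : Setω where
  constructor _,_
  field
    witness : Sentence
    holds   : P witness

{-# OPTIONS --safe #-}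
module Submission where

open import Defs
open import Axiom.ExcludedMiddle using (ExcludedMiddle)
open import Algebra.Lattice.Bundles using (Lattice)
open import Algebra.Lattice.Structures using (IsDistributiveLattice)
import Algebra.Lattice.Properties.Lattice as LatticeProperties
open import Data.Empty using (⊥; ⊥-elim)
open import Data.Fin using (zero; suc)
open import Data.Product using (Σ; _×_; _,_)
open import Data.Unit using (⊤; tt)
open import Level using (Level; Lift; lift)
open import Relation.Binary.PropositionalEquality
  using (_≡_; _≢_; sym; trans; cong; cong₂; subst; module ≡-Reasoning)

-- Pick d ∈ D with d ≠ 𝟏. The names
-- ∅ and {∅ ↦ d} give x ∈ y the value d, and d* = d, so ⟦φ⟧ ≥ d is
-- designated. By coboundedness ⟦φ⟧ = 𝟏 would force some c ∧ c* = 𝟏, i.e.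
-- c = 𝟏 = c*, impossible since 𝟏* = 𝟎. Hence ⟦φ⟧ ∈ D ∖ {𝟏}, so
-- ⟦¬φ⟧ = ⟦φ⟧* = ⟦φ⟧ and ⟦φ ∧ ¬φ⟧ = ⟦φ⟧ ∈ D. Only the values of the atomic
-- formula x ∈ y matter, so BA and PA are handled by the same argument.

∃∈∧∉ : Sentence
∃∈∧∉ = ∃' (∃' ((suc zero ∈' zero) ∧' (¬' (suc zero ∈' zero))))

module CoboundedProperties {a j : Level} (𝔸 : DCobounded a j) where
  open DCobounded 𝔸
  open IsDistributiveLattice isDistributiveLattice using (isLattice; ∧-comm; ∧-assoc)

  lattice : Lattice a a
  lattice = record { isLattice = isLattice }

  open LatticeProperties lattice using (∧-idem)

  ≤-antisym : ∀ x y → x ≤ y → y ≤ x → x ≡ y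
  ≤-antisym x y x≤y y≤x = trans (sym x≤y) (trans (∧-comm x y) y≤x)

  ≤-trans : ∀ x y z → x ≤ y → y ≤ z → x ≤ z
  ≤-trans x y z x≤y y≤z = begin
    x ∧ z        ≡⟨ cong (_∧ z) (sym x≤y) ⟩
    (x ∧ y) ∧ z  ≡⟨ ∧-assoc x y z ⟩
    x ∧ (y ∧ z)  ≡⟨ cong (x ∧_) y≤z ⟩
    x ∧ y        ≡⟨ x≤y ⟩
    x            ∎
    where open ≡-Reasoning

  ⋀-empty : ∀ {I} (f : I → Carrier) → (I → ⊥) → ⋀ f ≡ 𝟏
  ⋀-empty f empty = ≤-antisym _ _ (𝟏-greatest _) (⋀-greatest f 𝟏 (λ i → ⊥-elim (empty i)))

  ⋁-const : ∀ {I} (f : I → Carrier) d → I → (∀ i → f i ≡ d) → ⋁ f ≡ d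
  ⋁-const f d i₀ f≡d = ≤-antisym _ _ (⋁-least f d fi≤d) d≤⋁f
    where
    fi≤d : ∀ i → f i ≤ d
    fi≤d i = subst (_≤ d) (sym (f≡d i)) (∧-idem d)
    d≤⋁f : d ≤ ⋁ f
    d≤⋁f = subst (_≤ ⋁ f) (f≡d i₀) (⋁-upper f i₀)

  ∧≡𝟏⇒ˡ≡𝟏 : ∀ x y → x ∧ y ≡ 𝟏 → x ≡ 𝟏
  ∧≡𝟏⇒ˡ≡𝟏 x y x∧y≡𝟏 = begin
    x            ≡⟨ sym (𝟏-greatest x) ⟩
    x ∧ 𝟏        ≡⟨ cong (x ∧_) (sym x∧y≡𝟏) ⟩
    x ∧ (x ∧ y)  ≡⟨ sym (∧-assoc x x y) ⟩
    (x ∧ x) ∧ y  ≡⟨ cong (_∧ y) (∧-idem x) ⟩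
    x ∧ y        ≡⟨ x∧y≡𝟏 ⟩
    𝟏            ∎
    where open ≡-Reasoning

  ∧≡𝟏⇒ʳ≡𝟏 : ∀ x y → x ∧ y ≡ 𝟏 → y ≡ 𝟏
  ∧≡𝟏⇒ʳ≡𝟏 x y x∧y≡𝟏 = ∧≡𝟏⇒ˡ≡𝟏 y x (trans (∧-comm y x) x∧y≡𝟏)

  𝟎≢𝟏 : 𝟎 ≢ 𝟏
  𝟎≢𝟏 𝟎≡𝟏 = D-𝟎 (subst D (sym 𝟎≡𝟏) D-𝟏)

  x∧x*≢𝟏 : ∀ x → x ∧ x * ≢ 𝟏
  x∧x*≢𝟏 x x∧x*≡𝟏 = 𝟎≢𝟏 (trans (sym (*-𝟏 x (∧≡𝟏⇒ˡ≡𝟏 _ _ x∧x*≡𝟏))) (∧≡𝟏⇒ʳ≡𝟏 _ _ x∧x*≡𝟏))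

  x∧x*≡x : ∀ x → D x → x ≢ 𝟏 → x ∧ x * ≡ x
  x∧x*≡x x Dx x≢𝟏 = trans (cong (x ∧_) (*-D x Dx x≢𝟏)) (∧-idem x)

  designated≢𝟏 : AtLeastTwoDesignated 𝔸 → Σ Carrier λ d → D d × d ≢ 𝟏
  designated≢𝟏 (x , y , Dx , Dy , x≢y) = x ∧ y , D-∧ x y Dx Dy , x∧y≢𝟏
    where
    x∧y≢𝟏 : x ∧ y ≢ 𝟏
    x∧y≢𝟏 x∧y≡𝟏 = x≢y (trans (∧≡𝟏⇒ˡ≡𝟏 x y x∧y≡𝟏) (sym (∧≡𝟏⇒ʳ≡𝟏 x y x∧y≡𝟏)))

  module _ (mem eq : Name 𝔸 → Name 𝔸 → Carrier) where

    ⟦_⟧ : Sentence → Carrier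
    ⟦ φ ⟧ = eval 𝔸 mem eq φ (emptyEnv 𝔸)

    ⟦∃∈∧∉⟧≢𝟏 : ⟦ ∃∈∧∉ ⟧ ≢ 𝟏
    ⟦∃∈∧∉⟧≢𝟏 ⟦φ⟧≡𝟏 with ⋁-cobounded _ ⟦φ⟧≡𝟏
    ... | x , ⋁y≡𝟏 with ⋁-cobounded _ ⋁y≡𝟏
    ... | y , instance≡𝟏 = x∧x*≢𝟏 (mem x y) instance≡𝟏

    designated-⟦∃∈∧∉⟧ : ∀ u v d → mem u v ≡ d → D d → d ≢ 𝟏 → D ⟦ ∃∈∧∉ ⟧
    designated-⟦∃∈∧∉⟧ u v d u∈v≡d Dd d≢𝟏 = D-up d _ Dd d≤⟦φ⟧
      where
      instance≡d : mem u v ∧ mem u v * ≡ d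
      instance≡d = trans (cong (λ c → c ∧ c *) u∈v≡d) (x∧x*≡x d Dd d≢𝟏)
      d≤⟦φ⟧ : d ≤ ⟦ ∃∈∧∉ ⟧
      d≤⟦φ⟧ = subst (_≤ _) instance≡d
        (≤-trans _ _ _ (⋁-upper _ v) (⋁-upper (λ x → ⋁ (λ y → mem x y ∧ mem x y *)) u))

    designated-paradox : ∀ u v d → mem u v ≡ d → D d → d ≢ 𝟏 →
                         D ⟦ ∃∈∧∉ ∧' (¬' ∃∈∧∉) ⟧
    designated-paradox u v d u∈v≡d Dd d≢𝟏 =
      subst D (sym (x∧x*≡x _ D⟦φ⟧ ⟦∃∈∧∉⟧≢𝟏)) D⟦φ⟧
      where
      D⟦φ⟧ : D ⟦ ∃∈∧∉ ⟧
      D⟦φ⟧ = designated-⟦∃∈∧∉⟧ u v d u∈v≡d Dd d≢𝟏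

  ∅ : Name 𝔸
  ∅ = sup (Lift j ⊥) (λ ()) (λ ())

  ｛∅↦_｝ : Carrier → Name 𝔸
  ｛∅↦ d ｝ = sup (Lift j ⊤) (λ _ → ∅) (λ _ → d)

  eqBA-∅-∅ : eqBA 𝔸 ∅ ∅ ≡ 𝟏
  eqBA-∅-∅ = trans (cong₂ _∧_ (⋀-empty _ λ ()) (⋀-empty _ λ ())) (∧-idem 𝟏)

  eqPA-∅-∅ : eqPA 𝔸 ∅ ∅ ≡ 𝟏
  eqPA-∅-∅ = trans (cong₂ _∧_ (⋀-empty _ λ ()) (⋀-empty _ λ ())) (∧-idem 𝟏)

  memBA-∅-｛∅↦d｝ : ∀ d → memBA 𝔸 ∅ ｛∅↦ d ｝ ≡ d
  memBA-∅-｛∅↦d｝ d = ⋁-const _ d (lift (lift tt)) λ _ → trans (cong (d ∧_) eqBA-∅-∅) (𝟏-greatest d)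

  memPA-∅-｛∅↦d｝ : ∀ d → memPA 𝔸 ∅ ｛∅↦ d ｝ ≡ d
  memPA-∅-｛∅↦d｝ d = ⋁-const _ d (lift (lift tt)) λ _ → trans (cong (d ∧_) eqPA-∅-∅) (𝟏-greatest d)

mainTheorem3 : (∀ {ℓ} → ExcludedMiddle ℓ) →
    ΣSentenceω (λ φ → ∀ {a j} (𝔸 : DCobounded a j) → AtLeastTwoDesignated 𝔸 →
      ⊨BA 𝔸 (φ ∧' (¬' φ)) × ⊨PA 𝔸 (φ ∧' (¬' φ)))
mainTheorem3 _ = ∃∈∧∉ , λ 𝔸 twoDesignated →
  let open CoboundedProperties 𝔸
      (d , Dd , d≢𝟏) = designated≢𝟏 twoDesignated
  in designated-paradox (memBA 𝔸) (eqBA 𝔸) ∅ ｛∅↦ d ｝ d (memBA-∅-｛∅↦d｝ d) Dd d≢𝟏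
   , designated-paradox (memPA 𝔸) (eqPA 𝔸) ∅ ｛∅↦ d ｝ d (memPA-∅-｛∅↦d｝ d) Dd d≢𝟏
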